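{- In any network game that admits a (globally) stable matching, every stable matching $M$ satisfies $|M^*|\le 2|M|$, where $M^*$ is a maximum locally stable matching; i.e., every stable matching is a $2$-approximation for the maximum locally stable matching.
   Context: A network game consists of a set $V$ of players, a network $N=(V,L)$ of links, and a set $E$ of potential matching edges; a state is a matching $M\subseteq E$. Each player has a strict preference order over its possible partners (those $w$ with $\{v,w\}\in E$) and prefers being matched to being unmatched. A blocking pair of $M$ is a pair $\{u,v\}\in E$ such that each of $u,v$ is unmatched or strictly prefers the other to its current partner; a (globally) stable matching has no blocking pair. In state $M$, two players are accessible if their distance in $(V,L\cup M)$ is at most $2$; a local blocking pair is a blocking pair of accessible players, and a locally stable matching is a matching with no local blocking pair. A maximum locally stable matching is a locally stable matching of maximum cardinality. -}

module Defs where

open import Data.Nat using (ℕ; _<_; _≤_; _*_)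
open import Data.Fin using (Fin)
open import Data.Product using (Σ; ∃; ∃-syntax; _×_; _,_)
open import Data.Sum using (_⊎_)
open import Data.List using (List; length)
open import Data.List.Membership.Propositional using (_∈_)
open import Data.List.Relation.Unary.All using (All)
open import Data.List.Relation.Unary.AllPairs using (AllPairs)
open import Relation.Nullary using (¬_)
open import Relation.Binary.PropositionalEquality using (_≡_)

-- A network game on the finite player set V = Fin n.
--  * L : link relation of the network N = (V, L) (symmetric)
--  * E : potential matching edges (symmetric, irreflexive)
--  * rank v w : position of w in v's strict preference list
--    (smaller = more preferred); injective on v's possible partners,
--    so preferences are strict total orders over possible partners.
record NetworkGame : Set₁ where
  field
    n       : ℕ
    L       : Fin n → Fin n → Set
    L-sym   : ∀ {u v} → L u v → L v u
    E       : Fin n → Fin n → Set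
    E-sym   : ∀ {u v} → E u v → E v u
    E-irr   : ∀ {u} → ¬ E u u
    rank    : Fin n → Fin n → ℕ
    rank-inj : ∀ {v w w'} → E v w → E v w' → rank v w ≡ rank v w' → w ≡ w'

module _ (G : NetworkGame) where
  open NetworkGame G

  Player : Set
  Player = Fin n

  Prefers : Player → Player → Player → Set
  Prefers v w w' = rank v w < rank v w'

  -- A set of edges, each edge an (unordered) pair listed once as (u , v).
  EdgeList : Set
  EdgeList = List (Player × Player)

  Disjoint : Player × Player → Player × Player → Set
  Disjoint (a , b) (c , d) =
    ¬ a ≡ c × ¬ a ≡ d × ¬ b ≡ c × ¬ b ≡ d

  -- M ⊆ E and the edges of M are pairwise disjoint (so |M| = length M).
  IsMatching : EdgeList → Set
  IsMatching M = All (λ { (u , v) → E u v }) M × AllPairs Disjoint M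

  MatchedTo : EdgeList → Player → Player → Set
  MatchedTo M u v = (u , v) ∈ M ⊎ (v , u) ∈ M

  Unmatched : EdgeList → Player → Set
  Unmatched M u = ∀ w → ¬ MatchedTo M u w

  WantsToSwitch : EdgeList → Player → Player → Set
  WantsToSwitch M u v =
    Unmatched M u ⊎ (∃[ w ] (MatchedTo M u w × Prefers u v w))

  BlockingPair : EdgeList → Player → Player → Set
  BlockingPair M u v = E u v × WantsToSwitch M u v × WantsToSwitch M v u

  IsStable : EdgeList → Set
  IsStable M = IsMatching M × (∀ u v → ¬ BlockingPair M u v)

  Adj : EdgeList → Player → Player → Set
  Adj M u v = L u v ⊎ MatchedTo M u v

  Accessible : EdgeList → Player → Player → Set
  Accessible M u v = u ≡ v ⊎ Adj M u v ⊎ (∃[ w ] (Adj M u w × Adj M w v))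

  LocalBlockingPair : EdgeList → Player → Player → Set
  LocalBlockingPair M u v = BlockingPair M u v × Accessible M u v

  IsLocallyStable : EdgeList → Set
  IsLocallyStable M = IsMatching M × (∀ u v → ¬ LocalBlockingPair M u v)

  IsMaxLocallyStable : EdgeList → Set
  IsMaxLocallyStable M =
    IsLocallyStable M × (∀ M' → IsLocallyStable M' → length M' ≤ length M)

module Submission where

open import Defs
open import Function using (_∘_)
open import Data.Nat using (suc; _+_; _≤_; _*_; z≤n; s≤s)
open import Data.Nat.Properties using (*-suc; ≤-trans; ≤-reflexive)
open import Data.Product using (∃-syntax; _×_; _,_)
open import Data.Sum using (_⊎_; inj₁; inj₂)
open import Data.List using (List; []; _∷_; length)
open import Data.List.Properties using (length-removeAt′)
open import Data.List.Membership.Propositional using (_∈_; _∉_)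
open import Data.List.Relation.Unary.Any using (here; there; index; _─_)
open import Data.List.Relation.Unary.All as All using (All; []; _∷_)
open import Data.List.Relation.Unary.AllPairs as AllPairs using (AllPairs; []; _∷_)
open import Data.Fin.Properties using (_≟_)
open import Data.Empty using (⊥-elim)
open import Relation.Nullary using (yes; no)
open import Relation.Binary.PropositionalEquality using (_≡_; _≢_; refl; sym; trans; cong)

-- Stable matchings are maximal, since an edge with both endpoints unmatched
-- would block.  The edges of M* are pairwise disjoint and each meets one of
-- the 2|M| endpoints of M; charging every edge of M* to such an endpoint is
-- injective, so |M*| ≤ 2|M|.

module _ {A : Set} where

  ∈-─ : ∀ {x y} {xs : List A} (x∈xs : x ∈ xs) → y ∈ xs → y ≢ x → y ∈ (xs ─ x∈xs)
  ∈-─ (here refl) (here refl) y≢x = ⊥-elim (y≢x refl)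
  ∈-─ (here _)    (there y∈xs) _   = y∈xs
  ∈-─ (there _)   (here y≡z)   _   = here y≡z
  ∈-─ (there x∈xs) (there y∈xs) y≢x = there (∈-─ x∈xs y∈xs y≢x)

  SharesNoEndpoint : A × A → A × A → Set
  SharesNoEndpoint (a , b) (c , d) = a ≢ c × a ≢ d × b ≢ c × b ≢ d

  Avoids : A → A × A → Set
  Avoids x (c , d) = x ≢ c × x ≢ d

  Meets : List A → A × A → Set
  Meets X (c , d) = c ∈ X ⊎ d ∈ X

  sharesNoEndpoint⇒avoidsˡ : ∀ {a b} e → SharesNoEndpoint (a , b) e → Avoids a e
  sharesNoEndpoint⇒avoidsˡ _ (a≢c , a≢d , _ , _) = a≢c , a≢d

  sharesNoEndpoint⇒avoidsʳ : ∀ {a b} e → SharesNoEndpoint (a , b) e → Avoids b e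
  sharesNoEndpoint⇒avoidsʳ _ (_ , _ , b≢c , b≢d) = b≢c , b≢d

  meets-─ : ∀ {x X} (x∈X : x ∈ X) e → Avoids x e → Meets X e → Meets (X ─ x∈X) e
  meets-─ x∈X _ (x≢c , _) (inj₁ c∈X) = inj₁ (∈-─ x∈X c∈X (x≢c ∘ sym))
  meets-─ x∈X _ (_ , x≢d) (inj₂ d∈X) = inj₂ (∈-─ x∈X d∈X (x≢d ∘ sym))

  all-meets-─ : ∀ {x X S} (x∈X : x ∈ X) →
    All (Avoids x) S → All (Meets X) S → All (Meets (X ─ x∈X)) S
  all-meets-─ x∈X avoids meets =
    All.zipWith (λ { {e} (avoid , meet) → meets-─ x∈X e avoid meet }) (avoids , meets)

  ≤-length-─ : ∀ {x n} {X : List A} (x∈X : x ∈ X) → n ≤ length (X ─ x∈X) → suc n ≤ length X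
  ≤-length-─ {X = X} x∈X n≤ =
    ≤-trans (s≤s n≤) (≤-reflexive (sym (length-removeAt′ X (index x∈X))))

  disjoint-meeting-length-≤ : ∀ {S X} →
    AllPairs SharesNoEndpoint S → All (Meets X) S → length S ≤ length X
  disjoint-meeting-length-≤ [] [] = z≤n
  disjoint-meeting-length-≤ (disj ∷ disjs) (inj₁ a∈X ∷ meets) =
    ≤-length-─ a∈X (disjoint-meeting-length-≤ disjs
      (all-meets-─ a∈X (All.map (sharesNoEndpoint⇒avoidsˡ _) disj) meets))
  disjoint-meeting-length-≤ (disj ∷ disjs) (inj₂ b∈X ∷ meets) =
    ≤-length-─ b∈X (disjoint-meeting-length-≤ disjs
      (all-meets-─ b∈X (All.map (sharesNoEndpoint⇒avoidsʳ _) disj) meets))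

  endpoints : List (A × A) → List A
  endpoints [] = []
  endpoints ((u , v) ∷ M) = u ∷ v ∷ endpoints M

  length-endpoints : (M : List (A × A)) → length (endpoints M) ≡ 2 * length M
  length-endpoints [] = refl
  length-endpoints (_ ∷ M) =
    trans (cong (2 +_) (length-endpoints M)) (sym (*-suc 2 (length M)))

  ∈-endpointsˡ : ∀ {u w M} → (u , w) ∈ M → u ∈ endpoints M
  ∈-endpointsˡ (here refl) = here refl
  ∈-endpointsˡ (there p)   = there (there (∈-endpointsˡ p))

  ∈-endpointsʳ : ∀ {u w M} → (w , u) ∈ M → u ∈ endpoints M
  ∈-endpointsʳ (here refl) = there (here refl)
  ∈-endpointsʳ (there p)   = there (there (∈-endpointsʳ p))

module _ (G : NetworkGame) where
  open NetworkGame G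
  open import Data.List.Membership.DecPropositional (_≟_ {n}) using (_∈?_)

  ∉-endpoints⇒unmatched : ∀ {M u} → u ∉ endpoints M → Unmatched G M u
  ∉-endpoints⇒unmatched u∉ _ (inj₁ p) = u∉ (∈-endpointsˡ p)
  ∉-endpoints⇒unmatched u∉ _ (inj₂ p) = u∉ (∈-endpointsʳ p)

  stable⇒maximal : ∀ {M u v} → IsStable G M → E u v → Meets (endpoints M) (u , v)
  stable⇒maximal {M} {u} {v} (_ , unblocked) uv∈E with u ∈? endpoints M | v ∈? endpoints M
  ... | yes u∈ | _     = inj₁ u∈
  ... | no _   | yes v∈ = inj₂ v∈
  ... | no u∉  | no v∉  = ⊥-elim (unblocked u v
        (uv∈E , inj₁ (∉-endpoints⇒unmatched u∉) , inj₁ (∉-endpoints⇒unmatched v∉)))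

  matching-length-≤-twice-stable : ∀ {M M′} →
    IsStable G M → IsMatching G M′ → length M′ ≤ 2 * length M
  matching-length-≤-twice-stable {M} stable (inE , disjoint) = ≤-trans
    (disjoint-meeting-length-≤
      -- Disjoint G is SharesNoEndpoint once both pairs are split
      (AllPairs.map (λ { {_ , _} {_ , _} d → d }) disjoint)
      (All.map (λ { {_ , _} uv∈E → stable⇒maximal stable uv∈E }) inE))
    (≤-reflexive (length-endpoints M))

proposition17 : (G : NetworkGame) → (∃[ M₀ ] IsStable G M₀) →
    ∀ M Mstar → IsStable G M → IsMaxLocallyStable G Mstar →
    length Mstar ≤ 2 * length M
proposition17 G _ M Mstar stable ((matching , _) , _) = matching-length-≤-twice-stable G stable matching
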